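{- Let $n\geq 4$ and let $\Sigma_n$ be the $n$-th Schreier graph of the Basilica group. For $k\geq 1$ let $a^n_{2^k}$ (resp. $b^n_{2^k}$) denote the number of cycles of length $2^k$ labeled by $a$ (resp. by $b$) in $\Sigma_n$. Then for $n$ odd: $a^n_{2^k}=2^{n-2k-1}$ for $1\leq k\leq \frac{n-1}{2}-1$ and $a^n_{2^k}=2$ for $k=\lfloor n/2\rfloor$; $b^n_{2^k}=2^{n-2k}$ for $1\leq k\leq\frac{n-1}{2}-1$, $b^n_{2^k}=2$ for $k=\lfloor n/2\rfloor$, and $b^n_{2^k}=1$ for $k=\lceil n/2\rceil$. For $n$ even: $a^n_{2^k}=2^{n-2k-1}$ for $1\leq k\leq\frac n2-1$ and $a^n_{2^k}=1$ for $k=\frac n2$; $b^n_{2^k}=2^{n-2k}$ for $1\leq k\leq \frac n2-1$ and $b^n_{2^k}=2$ for $k=\frac n2$.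
   Context: Automorphisms of the rooted binary tree (vertices = finite words over $\{0,1\}$) are written $g=\tau(g_0,g_1)$, meaning $g(xw)=\tau(x)g_x(w)$ for a letter $x$ and a finite word $w$, with $\tau\in Sym(2)$; $e$ is the trivial and $\epsilon$ the non-trivial permutation. The Basilica group is generated by $a=e(b,id)$ and $b=\epsilon(a,id)$, i.e. $a(0w)=0b(w)$, $a(1w)=1w$, $b(0w)=1a(w)$, $b(1w)=0w$. Its $n$-th Schreier graph $\Sigma_n$ has vertex set the $2^n$ words of length $n$ over $\{0,1\}$; for each $s\in\{a,b\}$ and each vertex $u$ with $s(u)\neq u$ there is one edge joining $u$ and $s(u)$, labeled $s$; loops are erased. Thus each orbit of $\langle s\rangle$ of size $k\geq 2$ on the vertices gives a cycle of length $k$ labeled by $s$ (a double edge when $k=2$); these are the cycles labeled by $s$. -}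

module Defs where

open import Data.Nat using (ℕ; zero; suc; _^_; _/_; _≟_)
open import Data.Bool using (Bool; true; false)
import Data.Bool as B
open import Data.Vec using (Vec; []; _∷_)
open import Data.Vec.Properties using (≡-dec)
open import Data.List using (List; []; _∷_; map; _++_; length; filter)
open import Relation.Nullary using (Dec; yes; no)
open import Relation.Binary.PropositionalEquality using (_≡_)
open import Data.Nat.Properties using (m^n≢0)
open import Relation.Nullary.Decidable using (⌊_⌋)

-- Letters: false = 0, true = 1.  Vertices of Σ_n: Vec Bool n.
Word : ℕ → Set
Word n = Vec Bool n

-- a = e(b, id), b = ε(a, id)
mutual
  actA : ∀ {n} → Word n → Word n
  actA [] = []
  actA (false ∷ w) = false ∷ actB w
  actA (true ∷ w) = true ∷ w

  actB : ∀ {n} → Word n → Word n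
  actB [] = []
  actB (false ∷ w) = true ∷ actA w
  actB (true ∷ w) = false ∷ w

data Gen : Set where
  a b : Gen

act : Gen → ∀ {n} → Word n → Word n
act a = actA
act b = actB

allWords : (n : ℕ) → List (Word n)
allWords zero = [] ∷ []
allWords (suc n) = map (false ∷_) (allWords n) ++ map (true ∷_) (allWords n)

_≟w_ : ∀ {n} (u v : Word n) → Dec (u ≡ v)
_≟w_ = ≡-dec B._≟_

-- search for the least j ≥ start with s^j(u) = u, where v = s^start(u)
periodSearch : ∀ {n} → Gen → (fuel : ℕ) → (j : ℕ) → (v u : Word n) → ℕ
periodSearch s zero j v u = j
periodSearch s (suc fuel) j v u with v ≟w u
... | yes _ = j
... | no _ = periodSearch s fuel (suc j) (act s v) u

-- size of the orbit of u under ⟨s⟩: least j ≥ 1 with s^j(u) = u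
-- (fuel 2^n suffices since the orbit has at most 2^n elements)
orbitSize : Gen → ∀ {n} → Word n → ℕ
orbitSize s {n} u = periodSearch s (2 ^ n) 1 (act s u) u

verticesInOrbitsOfSize : Gen → (n m : ℕ) → ℕ
verticesInOrbitsOfSize s n m = length (filter (λ u → orbitSize s u ≟ m) (allWords n))

-- number of cycles of length 2^k labeled by s in Σ_n
-- = number of ⟨s⟩-orbits of size 2^k on words of length n
-- = (#vertices lying in orbits of size 2^k) / 2^k
cycles2^ : Gen → (n k : ℕ) → ℕ
cycles2^ s n k = _/_ (verticesInOrbitsOfSize s n (2 ^ k)) (2 ^ k) {{m^n≢0 2 k}}

-- b² fixes the first letter and acts on the rest as a, while a fixes 1w and acts on 0w as b
-- on w; so the a-orbit of 0w has the size of the b-orbit of w, the a-orbit of 1w is trivial,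
-- and the b-orbit of xw is twice the a-orbit of w. Hence the words of length n + 2 in a-orbits
-- of size 2^(k+1), and those of length n + 1 in b-orbits of size 2^(k+1), are twice as many as
-- the words of length n in a-orbits of size 2^k: all three families have equally many orbits.
-- Iterating, the a-cycles of length 2^k on level 2k + j are as many as the words of length j
-- fixed by a, which number 1, 2 and 2^(j-1) for j = 0, j = 1 and j ≥ 2.
module Submission where

open import Defs
open import Data.Nat
  using (ℕ; zero; suc; _+_; _*_; _∸_; _^_; _/_; _%_; ⌊_/2⌋; ⌈_/2⌉; _≟_; _≤_; z≤n; s≤s; s≤s⁻¹)
open import Data.Nat.Properties
open import Data.Nat.DivMod using (n/1≡n; m*n/m*o≡n/o)
open import Data.Bool using (false; true)
open import Data.Vec using (_∷_; [])
open import Data.Vec.Properties using (∷-injectiveʳ)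
open import Data.List using (List; []; _∷_; map; _++_; length; filter)
open import Data.List.Properties
  using (length-++; length-map; filter-++; filter-≐; filter-all; filter-none)
open import Data.List.Relation.Unary.All using (universal)
open import Data.Product using (_×_; _,_)
open import Data.Empty using (⊥-elim)
open import Function using (_∘_)
open import Function.Definitions using (Injective)
open import Relation.Nullary using (yes; no; does)
open import Relation.Binary.PropositionalEquality
  using (_≡_; _≢_; refl; sym; trans; cong; cong₂; subst; _≗_; module ≡-Reasoning)

private
  variable
    n : ℕ

data EvenOrOdd : ℕ → Set where
  even : ∀ j → EvenOrOdd (2 * j)
  odd  : ∀ j → EvenOrOdd (suc (2 * j))

evenOrOdd : ∀ i → EvenOrOdd i
evenOrOdd zero = even 0
evenOrOdd (suc i) with evenOrOdd i
... | even j = odd j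
... | odd j = subst EvenOrOdd (*-suc 2 j) (even (suc j))

x+x≡2*x : ∀ x → x + x ≡ 2 * x
x+x≡2*x x = cong (x +_) (sym (+-identityʳ x))

2*⌊n/2⌋+n%2≡n : ∀ n → 2 * ⌊ n /2⌋ + n % 2 ≡ n
2*⌊n/2⌋+n%2≡n zero = refl
2*⌊n/2⌋+n%2≡n (suc zero) = refl
2*⌊n/2⌋+n%2≡n (suc (suc n)) =
  trans (cong (_+ n % 2) (*-suc 2 ⌊ n /2⌋)) (cong (2 +_) (2*⌊n/2⌋+n%2≡n n))

[1+n]%2≡1⇒n%2≡0 : ∀ n → suc n % 2 ≡ 1 → n % 2 ≡ 0
[1+n]%2≡1⇒n%2≡0 zero _ = refl
[1+n]%2≡1⇒n%2≡0 (suc zero) ()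
[1+n]%2≡1⇒n%2≡0 (suc (suc n)) = [1+n]%2≡1⇒n%2≡0 n

1≤k≤⌊m/2⌋∸1⇒2+2k≤m : ∀ {m k} → 1 ≤ k → k ≤ ⌊ m /2⌋ ∸ 1 → 2 + 2 * k ≤ m
1≤k≤⌊m/2⌋∸1⇒2+2k≤m {m} {k} 1≤k k≤ = begin
  2 + 2 * k            ≡⟨ *-suc 2 k ⟨
  2 * suc k            ≤⟨ *-monoʳ-≤ 2 (subst (_≤ ⌊ m /2⌋) (+-comm k 1) k+1≤⌊m/2⌋) ⟩
  2 * ⌊ m /2⌋          ≤⟨ m≤m+n _ (m % 2) ⟩
  2 * ⌊ m /2⌋ + m % 2  ≡⟨ 2*⌊n/2⌋+n%2≡n m ⟩
  m                    ∎
  where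
  open ≤-Reasoning
  k+1≤⌊m/2⌋ : k + 1 ≤ ⌊ m /2⌋
  k+1≤⌊m/2⌋ = m≤o∸n⇒m+n≤o k (≤-trans (≤-trans 1≤k k≤) (m∸n≤m _ 1)) k≤

act^ : Gen → ℕ → Word n → Word n
act^ s zero u = u
act^ s (suc i) u = act s (act^ s i u)

record IsMinimalPeriod (s : Gen) (u : Word n) (p : ℕ) : Set where
  field
    positive : 1 ≤ p
    returns  : act^ s p u ≡ u
    least    : ∀ {i} → 1 ≤ i → act^ s i u ≡ u → p ≤ i

module _ {s : Gen} {u : Word n} {p : ℕ} (P : IsMinimalPeriod s u p) where
  open IsMinimalPeriod P

  periodSearch-finds : ∀ fuel j → 1 ≤ j → j ≤ p → p ≤ j + fuel →
    periodSearch s fuel j (act^ s j u) u ≡ p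
  periodSearch-finds zero j _ j≤p p≤j+0 = ≤-antisym j≤p (subst (p ≤_) (+-identityʳ j) p≤j+0)
  periodSearch-finds (suc fuel) j 1≤j j≤p p≤j+1+fuel with act^ s j u ≟w u
  ... | yes returnsAt-j = ≤-antisym j≤p (least 1≤j returnsAt-j)
  ... | no ¬returnsAt-j = periodSearch-finds fuel (suc j) (m≤n⇒m≤1+n 1≤j)
          (≤∧≢⇒< j≤p λ { refl → ¬returnsAt-j returns })
          (subst (p ≤_) (+-suc j fuel) p≤j+1+fuel)

  orbitSize≡minimalPeriod : p ≤ 2 ^ n → orbitSize s u ≡ p
  orbitSize≡minimalPeriod p≤2^n = periodSearch-finds (2 ^ n) 1 ≤-refl positive (m≤n⇒m≤1+n p≤2^n)

fixedPoint-minimalPeriod : ∀ {s} {u : Word n} → act s u ≡ u → IsMinimalPeriod s u 1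
fixedPoint-minimalPeriod fixed =
  record { positive = ≤-refl ; returns = fixed ; least = λ 1≤i _ → 1≤i }

minimalPeriod-∷ : ∀ {s t x} {w : Word n} {p} → (∀ i → act^ s i (x ∷ w) ≡ x ∷ act^ t i w) →
  IsMinimalPeriod t w p → IsMinimalPeriod s (x ∷ w) p
minimalPeriod-∷ {x = x} {w} {p} act^-∷ P = record
  { positive = positive
  ; returns  = trans (act^-∷ p) (cong (x ∷_) returns)
  ; least    = λ {i} 1≤i e → least 1≤i (∷-injectiveʳ (trans (sym (act^-∷ i)) e))
  }
  where open IsMinimalPeriod P

act^-a-false : ∀ i (w : Word n) → act^ a i (false ∷ w) ≡ false ∷ act^ b i w
act^-a-false zero w = refl
act^-a-false (suc i) w = cong actA (act^-a-false i w)

actB²-∷ : ∀ x (w : Word n) → actB (actB (x ∷ w)) ≡ x ∷ actA w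
actB²-∷ false w = refl
actB²-∷ true w = refl

actB-moves-head : ∀ x (v w : Word n) → actB (x ∷ v) ≢ x ∷ w
actB-moves-head false v w ()
actB-moves-head true v w ()

act^-b-even : ∀ i x (w : Word n) → act^ b (2 * i) (x ∷ w) ≡ x ∷ act^ a i w
act^-b-even zero x w = refl
act^-b-even (suc i) x w = begin
  act^ b (2 * suc i) (x ∷ w)            ≡⟨ cong (λ m → act^ b m (x ∷ w)) (*-suc 2 i) ⟩
  actB (actB (act^ b (2 * i) (x ∷ w)))  ≡⟨ cong (actB ∘ actB) (act^-b-even i x w) ⟩
  actB (actB (x ∷ act^ a i w))          ≡⟨ actB²-∷ x (act^ a i w) ⟩
  x ∷ act^ a (suc i) w                  ∎
  where open ≡-Reasoning

act^-b-odd : ∀ i x (w : Word n) → act^ b (suc (2 * i)) (x ∷ w) ≢ x ∷ w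
act^-b-odd i x w e = actB-moves-head x (act^ a i w) w (trans (sym (cong actB (act^-b-even i x w))) e)

minimalPeriod-b-∷ : ∀ {p} x (w : Word n) → IsMinimalPeriod a w p → IsMinimalPeriod b (x ∷ w) (2 * p)
minimalPeriod-b-∷ {p = p} x w P = record
  { positive = ≤-trans positive (m≤n*m p 2)
  ; returns  = trans (act^-b-even p x w) (cong (x ∷_) returns)
  ; least    = least-b
  }
  where
  open IsMinimalPeriod P
  least-b : ∀ {i} → 1 ≤ i → act^ b i (x ∷ w) ≡ x ∷ w → 2 * p ≤ i
  least-b {i} 1≤i e with evenOrOdd i
  least-b {.(2 * zero)} () e | even zero
  ... | even (suc j) =
    *-monoʳ-≤ 2 (least (s≤s z≤n) (∷-injectiveʳ (trans (sym (act^-b-even (suc j) x w)) e)))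
  ... | odd j = ⊥-elim (act^-b-odd j x w e)

mutual
  periodA : Word n → ℕ
  periodA [] = 1
  periodA (false ∷ w) = periodB w
  periodA (true ∷ w) = 1

  periodB : Word n → ℕ
  periodB [] = 1
  periodB (_ ∷ w) = 2 * periodA w

period : Gen → Word n → ℕ
period a = periodA
period b = periodB

mutual
  periodA-minimal : (u : Word n) → IsMinimalPeriod a u (periodA u)
  periodA-minimal [] = fixedPoint-minimalPeriod refl
  periodA-minimal (false ∷ w) = minimalPeriod-∷ (λ i → act^-a-false i w) (periodB-minimal w)
  periodA-minimal (true ∷ w) = fixedPoint-minimalPeriod refl

  periodB-minimal : (u : Word n) → IsMinimalPeriod b u (periodB u)
  periodB-minimal [] = fixedPoint-minimalPeriod refl
  periodB-minimal (x ∷ w) = minimalPeriod-b-∷ x w (periodA-minimal w)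

mutual
  periodA≤2^n : (u : Word n) → periodA u ≤ 2 ^ n
  periodA≤2^n [] = ≤-refl
  periodA≤2^n {suc n} (false ∷ w) = ≤-trans (periodB≤2^n w) (m≤n*m (2 ^ n) 2)
  periodA≤2^n {suc n} (true ∷ w) = m^n>0 2 (suc n)

  periodB≤2^n : (u : Word n) → periodB u ≤ 2 ^ n
  periodB≤2^n [] = ≤-refl
  periodB≤2^n (x ∷ w) = *-monoʳ-≤ 2 (periodA≤2^n w)

orbitSize≡period : ∀ s (u : Word n) → orbitSize s u ≡ period s u
orbitSize≡period a u = orbitSize≡minimalPeriod (periodA-minimal u) (periodA≤2^n u)
orbitSize≡period b u = orbitSize≡minimalPeriod (periodB-minimal u) (periodB≤2^n u)

count : {A : Set} → (A → ℕ) → ℕ → List A → ℕ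
count f m xs = length (filter (λ x → f x ≟ m) xs)

module _ {A : Set} where

  count-++ : ∀ (f : A → ℕ) m xs ys → count f m (xs ++ ys) ≡ count f m xs + count f m ys
  count-++ f m xs ys =
    trans (cong length (filter-++ (λ x → f x ≟ m) xs ys)) (length-++ (filter _ xs))

  count-map : ∀ {B : Set} (f : B → ℕ) (g : A → B) m xs → count f m (map g xs) ≡ count (f ∘ g) m xs
  count-map f g m [] = refl
  count-map f g m (x ∷ xs) with does (f (g x) ≟ m)
  ... | true = cong suc (count-map f g m xs)
  ... | false = count-map f g m xs

  count-cong : ∀ {f g : A → ℕ} → f ≗ g → ∀ m xs → count f m xs ≡ count g m xs
  count-cong f≗g m xs =
    cong length (filter-≐ _ _ ((λ e → trans (sym (f≗g _)) e) , (λ e → trans (f≗g _) e)) xs)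

  count-injective : ∀ {h : ℕ → ℕ} → Injective _≡_ _≡_ h → ∀ (f : A → ℕ) m xs →
    count (h ∘ f) (h m) xs ≡ count f m xs
  count-injective {h} h-injective f m xs = cong length (filter-≐ _ _ (h-injective , cong h) xs)

  count-none : ∀ {f : A → ℕ} {m} → (∀ x → f x ≢ m) → ∀ xs → count f m xs ≡ 0
  count-none f≢m xs = cong length (filter-none _ (universal f≢m xs))

  count-all : ∀ {f : A → ℕ} {m} → (∀ x → f x ≡ m) → ∀ xs → count f m xs ≡ length xs
  count-all f≡m xs = cong length (filter-all _ (universal f≡m xs))

length-allWords : ∀ n → length (allWords n) ≡ 2 ^ n
length-allWords zero = refl
length-allWords (suc n) = begin
  length (map (false ∷_) ws ++ map (true ∷_) ws)      ≡⟨ length-++ (map (false ∷_) ws) ⟩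
  length (map (false ∷_) ws) + length (map (true ∷_) ws)
    ≡⟨ cong₂ _+_ (length-map (false ∷_) ws) (length-map (true ∷_) ws) ⟩
  length ws + length ws                                ≡⟨ cong (λ l → l + l) (length-allWords n) ⟩
  2 ^ n + 2 ^ n                                        ≡⟨ x+x≡2*x (2 ^ n) ⟩
  2 ^ suc n                                            ∎
  where
  open ≡-Reasoning
  ws = allWords n

count-allWords-suc : ∀ (f : Word (suc n) → ℕ) m → count f m (allWords (suc n)) ≡
  count (f ∘ (false ∷_)) m (allWords n) + count (f ∘ (true ∷_)) m (allWords n)
count-allWords-suc {n} f m = trans (count-++ f m (map (false ∷_) ws) (map (true ∷_) ws))
  (cong₂ _+_ (count-map f (false ∷_) m ws) (count-map f (true ∷_) m ws))
  where ws = allWords n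

#ofPeriod : Gen → ℕ → ℕ → ℕ
#ofPeriod s n m = count (period s) m (allWords n)

verticesInOrbitsOfSize≡#ofPeriod : ∀ s n m → verticesInOrbitsOfSize s n m ≡ #ofPeriod s n m
verticesInOrbitsOfSize≡#ofPeriod s n m = count-cong (orbitSize≡period s) m (allWords n)

#ofPeriod-a-suc : ∀ n m → #ofPeriod a (suc n) m ≡ #ofPeriod b n m + count (λ _ → 1) m (allWords n)
#ofPeriod-a-suc n m = count-allWords-suc {n} periodA m

#ofPeriod-b-suc-double : ∀ n m → #ofPeriod b (suc n) (2 * m) ≡ 2 * #ofPeriod a n m
#ofPeriod-b-suc-double n m = begin
  #ofPeriod b (suc n) (2 * m)                      ≡⟨ count-allWords-suc {n} periodB (2 * m) ⟩
  count ((2 *_) ∘ periodA) (2 * m) (allWords n) + count ((2 *_) ∘ periodA) (2 * m) (allWords n)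
    ≡⟨ cong (λ c → c + c) (count-injective (*-cancelˡ-≡ _ _ 2) periodA m (allWords n)) ⟩
  #ofPeriod a n m + #ofPeriod a n m                ≡⟨ x+x≡2*x (#ofPeriod a n m) ⟩
  2 * #ofPeriod a n m                              ∎
  where open ≡-Reasoning

#ofPeriod-b-suc-one : ∀ n → #ofPeriod b (suc n) 1 ≡ 0
#ofPeriod-b-suc-one n = count-none (λ { (_ ∷ w) → even≢odd (periodA w) 0 }) (allWords (suc n))

#ofPeriod-a-double : ∀ n m → #ofPeriod a (2 + n) (2 * m) ≡ 2 * #ofPeriod a n m
#ofPeriod-a-double n m = begin
  #ofPeriod a (2 + n) (2 * m)
    ≡⟨ #ofPeriod-a-suc (suc n) (2 * m) ⟩
  #ofPeriod b (suc n) (2 * m) + count (λ _ → 1) (2 * m) (allWords (suc n))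
    ≡⟨ cong₂ _+_ (#ofPeriod-b-suc-double n m)
                 (count-none (λ _ → even≢odd m 0 ∘ sym) (allWords (suc n))) ⟩
  2 * #ofPeriod a n m + 0
    ≡⟨ +-identityʳ _ ⟩
  2 * #ofPeriod a n m
    ∎
  where open ≡-Reasoning

#ofPeriod-a-one : ∀ n → #ofPeriod a (2 + n) 1 ≡ 2 ^ suc n
#ofPeriod-a-one n = begin
  #ofPeriod a (2 + n) 1                                    ≡⟨ #ofPeriod-a-suc (suc n) 1 ⟩
  #ofPeriod b (suc n) 1 + count (λ _ → 1) 1 (allWords (suc n))
    ≡⟨ cong₂ _+_ (#ofPeriod-b-suc-one n) (count-all (λ _ → refl) (allWords (suc n))) ⟩
  length (allWords (suc n))                                ≡⟨ length-allWords (suc n) ⟩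
  2 ^ suc n                                                ∎
  where open ≡-Reasoning

#ofPeriod-a-one-≥2 : ∀ {j} → 2 ≤ j → #ofPeriod a j 1 ≡ 2 ^ (j ∸ 1)
#ofPeriod-a-one-≥2 (s≤s (s≤s {n = j} _)) = #ofPeriod-a-one j

_/2^_ : ℕ → ℕ → ℕ
v /2^ k = _/_ v (2 ^ k) {{m^n≢0 2 k}}

cycles2^≡#ofPeriod/2^ : ∀ s n k → cycles2^ s n k ≡ #ofPeriod s n (2 ^ k) /2^ k
cycles2^≡#ofPeriod/2^ s n k = cong (_/2^ k) (verticesInOrbitsOfSize≡#ofPeriod s n (2 ^ k))

cycles2^-suc : ∀ s n n′ k → #ofPeriod s n′ (2 ^ suc k) ≡ 2 * #ofPeriod a n (2 ^ k) →
  cycles2^ s n′ (suc k) ≡ cycles2^ a n k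
cycles2^-suc s n n′ k #≡2*# = begin
  cycles2^ s n′ (suc k)                 ≡⟨ cycles2^≡#ofPeriod/2^ s n′ (suc k) ⟩
  #ofPeriod s n′ (2 ^ suc k) /2^ suc k   ≡⟨ cong (_/2^ suc k) #≡2*# ⟩
  (2 * #ofPeriod a n (2 ^ k)) /2^ suc k  ≡⟨ m*n/m*o≡n/o 2 _ (2 ^ k) {{m^n≢0 2 k}} {{m^n≢0 2 (suc k)}} ⟩
  #ofPeriod a n (2 ^ k) /2^ k            ≡⟨ cycles2^≡#ofPeriod/2^ a n k ⟨
  cycles2^ a n k                        ∎
  where open ≡-Reasoning

cycles2^-a-zero : ∀ n → cycles2^ a n 0 ≡ #ofPeriod a n 1
cycles2^-a-zero n = trans (cycles2^≡#ofPeriod/2^ a n 0) (n/1≡n _)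

cycles2^-a-suc : ∀ n k → cycles2^ a (2 + n) (suc k) ≡ cycles2^ a n k
cycles2^-a-suc n k = cycles2^-suc a n (2 + n) k (#ofPeriod-a-double n (2 ^ k))

cycles2^-b-suc : ∀ n k → cycles2^ b (suc n) (suc k) ≡ cycles2^ a n k
cycles2^-b-suc n k = cycles2^-suc b n (suc n) k (#ofPeriod-b-suc-double n (2 ^ k))

cycles2^-a-2k+j : ∀ k j → cycles2^ a (2 * k + j) k ≡ #ofPeriod a j 1
cycles2^-a-2k+j zero j = cycles2^-a-zero j
cycles2^-a-2k+j (suc k) j = begin
  cycles2^ a (2 * suc k + j) (suc k)    ≡⟨ cong (λ l → cycles2^ a (l + j) (suc k)) (*-suc 2 k) ⟩
  cycles2^ a (2 + (2 * k + j)) (suc k)  ≡⟨ cycles2^-a-suc (2 * k + j) k ⟩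
  cycles2^ a (2 * k + j) k              ≡⟨ cycles2^-a-2k+j k j ⟩
  #ofPeriod a j 1                       ∎
  where open ≡-Reasoning

cycles2^-a-at : ∀ n k → 2 * k ≤ n → cycles2^ a n k ≡ #ofPeriod a (n ∸ 2 * k) 1
cycles2^-a-at n k 2k≤n =
  trans (cong (λ l → cycles2^ a l k) (sym (m+[n∸m]≡n 2k≤n))) (cycles2^-a-2k+j k (n ∸ 2 * k))

cycles2^-a-bulk : ∀ n k → 2 + 2 * k ≤ n → cycles2^ a n k ≡ 2 ^ (n ∸ 2 * k ∸ 1)
cycles2^-a-bulk n k 2+2k≤n =
  trans (cycles2^-a-at n k (m+n≤o⇒n≤o 2 2+2k≤n))
        (#ofPeriod-a-one-≥2 (m+n≤o⇒m≤o∸n 2 2+2k≤n))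

cycles2^-b-bulk : ∀ n k → 1 ≤ k → 2 + 2 * k ≤ n → cycles2^ b n k ≡ 2 ^ (n ∸ 2 * k)
cycles2^-b-bulk zero (suc k) _ ()
cycles2^-b-bulk (suc n) (suc k) _ 2+2k≤n = begin
  cycles2^ b (suc n) (suc k)  ≡⟨ cycles2^-b-suc n k ⟩
  cycles2^ a n k              ≡⟨ cycles2^-a-bulk n k 2+2k≤n-1 ⟩
  2 ^ (n ∸ 2 * k ∸ 1)         ≡⟨ cong (2 ^_) exponent ⟩
  2 ^ (suc n ∸ 2 * suc k)     ∎
  where
  open ≡-Reasoning
  2+2k≤n-1 : 2 + 2 * k ≤ n
  2+2k≤n-1 = <⇒≤ (s≤s⁻¹ (subst (_≤ suc n) (cong (2 +_) (*-suc 2 k)) 2+2k≤n))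
  exponent : n ∸ 2 * k ∸ 1 ≡ suc n ∸ 2 * suc k
  exponent = begin
    n ∸ 2 * k ∸ 1          ≡⟨ ∸-+-assoc n (2 * k) 1 ⟩
    n ∸ (2 * k + 1)        ≡⟨ cong (n ∸_) (+-comm (2 * k) 1) ⟩
    suc n ∸ (2 + 2 * k)    ≡⟨ cong (suc n ∸_) (*-suc 2 k) ⟨
    suc n ∸ 2 * suc k      ∎

cycles2^-a-half : ∀ n → cycles2^ a n ⌊ n /2⌋ ≡ #ofPeriod a (n % 2) 1
cycles2^-a-half n =
  trans (cong (λ l → cycles2^ a l ⌊ n /2⌋) (sym (2*⌊n/2⌋+n%2≡n n)))
        (cycles2^-a-2k+j ⌊ n /2⌋ (n % 2))

cycles2^-b-half : ∀ n → 2 ≤ n → cycles2^ b n ⌊ n /2⌋ ≡ #ofPeriod a (suc (n % 2)) 1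
cycles2^-b-half (suc (suc n)) (s≤s (s≤s _)) = begin
  cycles2^ b (2 + n) (suc ⌊ n /2⌋)             ≡⟨ cycles2^-b-suc (suc n) ⌊ n /2⌋ ⟩
  cycles2^ a (suc n) ⌊ n /2⌋                   ≡⟨ cong (λ l → cycles2^ a l ⌊ n /2⌋) 1+n≡2h+1+r ⟩
  cycles2^ a (2 * ⌊ n /2⌋ + suc (n % 2)) ⌊ n /2⌋ ≡⟨ cycles2^-a-2k+j ⌊ n /2⌋ (suc (n % 2)) ⟩
  #ofPeriod a (suc (n % 2)) 1                   ∎
  where
  open ≡-Reasoning
  1+n≡2h+1+r : suc n ≡ 2 * ⌊ n /2⌋ + suc (n % 2)
  1+n≡2h+1+r = sym (trans (+-suc (2 * ⌊ n /2⌋) (n % 2)) (cong suc (2*⌊n/2⌋+n%2≡n n)))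

cycles2^-b-ceil : ∀ n → n % 2 ≡ 1 → cycles2^ b n ⌈ n /2⌉ ≡ 1
cycles2^-b-ceil (suc n) n-odd = begin
  cycles2^ b (suc n) (suc ⌊ n /2⌋)  ≡⟨ cycles2^-b-suc n ⌊ n /2⌋ ⟩
  cycles2^ a n ⌊ n /2⌋              ≡⟨ cycles2^-a-half n ⟩
  #ofPeriod a (n % 2) 1             ≡⟨ cong (λ r → #ofPeriod a r 1) ([1+n]%2≡1⇒n%2≡0 n n-odd) ⟩
  #ofPeriod a 0 1                   ≡⟨⟩
  1                                 ∎
  where open ≡-Reasoning

mainTheorem2 : ∀ (n : ℕ) → 4 ≤ n →
      (n % 2 ≡ 1 →
          (∀ k → 1 ≤ k → k ≤ ⌊ n ∸ 1 /2⌋ ∸ 1 → cycles2^ a n k ≡ 2 ^ (n ∸ 2 * k ∸ 1))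
        × cycles2^ a n ⌊ n /2⌋ ≡ 2
        × (∀ k → 1 ≤ k → k ≤ ⌊ n ∸ 1 /2⌋ ∸ 1 → cycles2^ b n k ≡ 2 ^ (n ∸ 2 * k))
        × cycles2^ b n ⌊ n /2⌋ ≡ 2
        × cycles2^ b n ⌈ n /2⌉ ≡ 1)
    × (n % 2 ≡ 0 →
          (∀ k → 1 ≤ k → k ≤ ⌊ n /2⌋ ∸ 1 → cycles2^ a n k ≡ 2 ^ (n ∸ 2 * k ∸ 1))
        × cycles2^ a n ⌊ n /2⌋ ≡ 1
        × (∀ k → 1 ≤ k → k ≤ ⌊ n /2⌋ ∸ 1 → cycles2^ b n k ≡ 2 ^ (n ∸ 2 * k))
        × cycles2^ b n ⌊ n /2⌋ ≡ 2)
-- The remaining fixed-point counts #ofPeriod a 1 1 and #ofPeriod a 2 1 evaluate to 2.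
mainTheorem2 n 4≤n =
    (λ n-odd →
        (λ k 1≤k k≤ → cycles2^-a-bulk n k (bulk-odd 1≤k k≤))
      , trans (cycles2^-a-half n) (cong (λ r → #ofPeriod a r 1) n-odd)
      , (λ k 1≤k k≤ → cycles2^-b-bulk n k 1≤k (bulk-odd 1≤k k≤))
      , trans (cycles2^-b-half n 2≤n) (cong (λ r → #ofPeriod a (suc r) 1) n-odd)
      , cycles2^-b-ceil n n-odd)
  , (λ n-even →
        (λ k 1≤k k≤ → cycles2^-a-bulk n k (1≤k≤⌊m/2⌋∸1⇒2+2k≤m 1≤k k≤))
      , trans (cycles2^-a-half n) (cong (λ r → #ofPeriod a r 1) n-even)
      , (λ k 1≤k k≤ → cycles2^-b-bulk n k 1≤k (1≤k≤⌊m/2⌋∸1⇒2+2k≤m 1≤k k≤))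
      , trans (cycles2^-b-half n 2≤n) (cong (λ r → #ofPeriod a (suc r) 1) n-even))
  where
  2≤n : 2 ≤ n
  2≤n = m+n≤o⇒n≤o 2 4≤n
  bulk-odd : ∀ {k} → 1 ≤ k → k ≤ ⌊ n ∸ 1 /2⌋ ∸ 1 → 2 + 2 * k ≤ n
  bulk-odd 1≤k k≤ = ≤-trans (1≤k≤⌊m/2⌋∸1⇒2+2k≤m 1≤k k≤) (m∸n≤m n 1)
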